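{- For all integers $c\ge1$ and $l\ge1$, $N_{1,2}(2c,l)=N_{JL}(2c,l)$.
   Context: The functions below count states (minus one) of two progress-measure spaces: $N_{JL}$ for the concise progress measures of Jurdziński and Lasić, and $N_{1,2}$ for the witnesses of Calude et al. restricted to contain each odd colour at most once and to use no odd colour above the highest even colour. Both are defined on arguments $(2c,l)$ with $c\ge1$, $l\ge0$ (resp. $l\ge1$). $N_{JL}$ is defined by: $N_{JL}(2c,0)=1$; $N_{JL}(2c,1)=2c+1$; $N_{JL}(2,l)=2^{l+1}-1$; and for $c\ge2$, $l\ge2$: $N_{JL}(2c,l)=N_{JL}(2c-2,l)+2N_{JL}(2c,l-1)$. $N_{1,2}$ is defined by: $N_{1,2}(2c,1)=2c+1$, and for $l\ge1$: $N_{1,2}(2c,l+1)=1+2\sum_{i=1}^{c}N_{1,2}(2i,l)$. -}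

module Defs where

open import Data.Nat using (ℕ; zero; suc; _+_; _*_; _∸_; _^_)

-- NJL c l  represents  N_JL(2c, l).  Defined for c ≥ 1, l ≥ 0;
-- the value at c = 0 is an unused junk value (0).
NJL : ℕ → ℕ → ℕ
NJL zero l = 0
NJL (suc k) zero = 1
NJL (suc k) (suc zero) = 2 * suc k + 1
NJL (suc zero) (suc (suc l)) = 2 ^ (suc (suc l) + 1) ∸ 1
NJL (suc (suc k)) (suc (suc l)) =
  NJL (suc k) (suc (suc l)) + 2 * NJL (suc (suc k)) (suc l)

sumTo : (ℕ → ℕ) → ℕ → ℕ
sumTo f zero = 0
sumTo f (suc c) = sumTo f c + f (suc c)

-- N12 c l  represents  N_{1,2}(2c, l).  Defined for l ≥ 1;
-- the value at l = 0 is an unused junk value (0).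
N12 : ℕ → ℕ → ℕ
N12 c zero = 0
N12 c (suc zero) = 2 * c + 1
N12 c (suc (suc l)) = 1 + 2 * sumTo (λ i → N12 i (suc l)) c

-- Splitting off the last summand of the defining sum gives the two-term recurrence
-- N₁,₂(2c+2, l+1) = N₁,₂(2c, l+1) + 2 N₁,₂(2c+2, l), which is that of N_JL; the base
-- column c = 1 solves x ↦ 2x + 1 from 3, i.e. 2^(l+1) − 1, and the base row l = 1
-- agrees by definition.
module Submission where

open import Defs
open import Data.Nat using (ℕ; _≤_; suc; _+_; _*_; _∸_; _^_)
open import Data.Nat.Properties using (*-distribˡ-+; m+n∸n≡m)
open import Data.Nat.Solver using (module +-*-Solver)
open import Relation.Binary.PropositionalEquality
  using (_≡_; refl; cong; cong₂; sym; module ≡-Reasoning)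

open +-*-Solver using (solve; _:+_; _:*_; _:=_; con)

-- Also valid at c = 0 (where N12 0 (l + 2) = 1), which yields the base column below.
N12-step : ∀ c l → N12 (suc c) (suc (suc l)) ≡ N12 c (suc (suc l)) + 2 * N12 (suc c) (suc l)
N12-step c l = cong suc (*-distribˡ-+ 2 (sumTo (λ i → N12 i (suc l)) c) (N12 (suc c) (suc l)))

N12-one-suc : ∀ l → N12 1 (suc l) + 1 ≡ 2 ^ (suc l + 1)
N12-one-suc 0 = refl
N12-one-suc (suc l) = begin
  N12 1 (suc (suc l)) + 1       ≡⟨ cong (_+ 1) (N12-step 0 l) ⟩
  1 + 2 * x + 1                 ≡⟨ solve 1 (λ x → con 1 :+ con 2 :* x :+ con 1 := con 2 :* (x :+ con 1)) refl x ⟩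
  2 * (x + 1)                   ≡⟨ cong (2 *_) (N12-one-suc l) ⟩
  2 ^ (suc (suc l) + 1)         ∎
  where
  open ≡-Reasoning
  x = N12 1 (suc l)

N12-one : ∀ l → N12 1 (suc l) ≡ 2 ^ (suc l + 1) ∸ 1
N12-one l = begin
  N12 1 (suc l)                 ≡⟨ sym (m+n∸n≡m (N12 1 (suc l)) 1) ⟩
  N12 1 (suc l) + 1 ∸ 1         ≡⟨ cong (_∸ 1) (N12-one-suc l) ⟩
  2 ^ (suc l + 1) ∸ 1           ∎
  where open ≡-Reasoning

N12≡NJL : ∀ c l → N12 (suc c) (suc l) ≡ NJL (suc c) (suc l)
N12≡NJL c 0 = refl
N12≡NJL 0 (suc l) = N12-one (suc l)
N12≡NJL (suc c) (suc l) = begin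
  N12 (suc (suc c)) (suc (suc l))                              ≡⟨ N12-step (suc c) l ⟩
  N12 (suc c) (suc (suc l)) + 2 * N12 (suc (suc c)) (suc l)    ≡⟨ cong₂ (λ a b → a + 2 * b) (N12≡NJL c (suc l)) (N12≡NJL (suc c) l) ⟩
  NJL (suc (suc c)) (suc (suc l))                              ∎
  where open ≡-Reasoning

mainTheorem8 : (c l : ℕ) → 1 ≤ c → 1 ≤ l → N12 c l ≡ NJL c l
mainTheorem8 (suc c) (suc l) _ _ = N12≡NJL c l
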